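{- For all positive integers $C$ and $s\geq 3$ there is $n_0$ such that for all $n\geq n_0$ the following holds. Let $G$ be an abelian group of order $n$. For every $g\in G$ and all $F_1,F_2\subseteq G$ with $|F_1|,|F_2|\leq C$, there exist $y_1,\dots,y_s\in G$ with $y_1+\dots+y_s=g$, $y_i\notin F_1$ for all $i$, and $y_i-y_j\notin F_2$ for all $i\neq j$. -}

module Defs where

open import Data.Nat using (ℕ; zero; suc)
open import Data.Fin using (Fin; zero; suc)

groupSum : ∀ {a} {A : Set a} → (A → A → A) → A → ∀ {s} → (Fin s → A) → A
groupSum _+_ 0# {zero}  y = 0#
groupSum _+_ 0# {suc s} y = y zero + groupSum _+_ 0# (λ i → y (suc i))

{-# OPTIONS --safe #-}
-- Write S = F₂ ∪ (−F₂), so that x and y are separated as soon as x − y ∉ S.  All summands but the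
-- last two are chosen greedily: each choice only has to avoid F₁ and the translates y + S of the
-- earlier ones, O(C s) values in all.  The last two are a and h − a, h being the remaining deficit,
-- and the one constraint on a that does not exclude boundedly many values is 2a − h ∉ S.  Once
-- h ∉ S − S − S, one of a₀, a₁, a₁ − a₀ satisfies it for suitably generic a₀, a₁, as otherwise
-- h = (2a₁ − h) − (2(a₁ − a₀) − h) − (2a₀ − h) ∈ S − S − S.  Finally h ∉ S − S − S costs only
-- (2C)³ more excluded values in the last greedy step.
module Submission where

open import Defs
open import Algebra.Bundles using (AbelianGroup)
open import Algebra.Core using (Op₁; Op₂)
import Algebra.Properties.AbelianGroup as AbelianGroupProperties
import Algebra.Properties.CommutativeSemigroup as CommutativeSemigroupProperties
open import Algebra.Structures using (IsAbelianGroup)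
open import Data.Fin using (Fin; zero; suc)
open import Data.Fin.Properties using (all?; ¬∀⟶∃¬; pigeonhole; <⇒≢; _≟_)
open import Data.Fin.Subset using (Subset; _∈_; _∉_; ∣_∣; inside; outside)
open import Data.List using (List; []; _++_; map; length; tabulate; cartesianProductWith)
open import Data.List.Properties using (length-++; length-map; length-tabulate)
open import Data.List.Membership.Propositional using () renaming (_∈_ to _∈ₗ_; _∉_ to _∉ₗ_)
open import Data.List.Membership.Propositional.Properties
  using (∈-map⁺; ∈-++⁺ˡ; ∈-++⁺ʳ; ∈-cartesianProductWith⁺; ∈-tabulate⁺)
open import Data.List.Membership.Setoid.Properties using (index-injective)
open import Data.List.Relation.Unary.Any using (any?; index; here; there)
open import Data.Nat using (ℕ; zero; suc; _≤_; _<_; _*_; s≤s) renaming (_+_ to _+ℕ_)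
open import Data.Nat.Properties
  using ( ≤-refl; ≤-reflexive; ≤-trans; ≤-<-trans; +-mono-≤; +-monoʳ-≤; *-mono-≤
        ; m≤m+n; m≤n+m; +-identityʳ)
open import Data.Product using (_×_; _,_; proj₁; proj₂; ∃; ∃-syntax)
open import Function using (_∘_)
open import Relation.Nullary using (yes; no; contradiction)
open import Relation.Binary.PropositionalEquality
  using (_≡_; _≢_; refl; sym; trans; cong; cong₂; subst; setoid; module ≡-Reasoning)

module _ {a} {A : Set a} where
  open import Data.List using (_∷_)

  length-++-≤ : ∀ (xs ys : List A) {m n} → length xs ≤ m → length ys ≤ n →
                length (xs ++ ys) ≤ m +ℕ n
  length-++-≤ xs _ p q = ≤-trans (≤-reflexive (length-++ xs)) (+-mono-≤ p q)

  length-map-≤ : ∀ {b} {B : Set b} (f : A → B) xs {m} → length xs ≤ m → length (map f xs) ≤ m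
  length-map-≤ f xs = ≤-trans (≤-reflexive (length-map f xs))

  length-cartesianProductWith : ∀ {b c} {B : Set b} {C : Set c} (f : A → B → C) xs ys →
    length (cartesianProductWith f xs ys) ≡ length xs * length ys
  length-cartesianProductWith f []       ys = refl
  length-cartesianProductWith f (x ∷ xs) ys = trans (length-++ (map (f x) ys))
    (cong₂ _+ℕ_ (length-map (f x) ys) (length-cartesianProductWith f xs ys))

length<n⇒∃∉ : ∀ {n} (xs : List (Fin n)) → length xs < n → ∃ (_∉ₗ xs)
length<n⇒∃∉ {n} xs |xs|<n with all? (λ x → any? (x ≟_) xs)
... | no ¬all = ¬∀⟶∃¬ n (_∈ₗ xs) (λ x → any? (x ≟_) xs) ¬all
... | yes all =
  let i , j , i<j , same-index = pigeonhole |xs|<n (λ x → index (all x))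
  in contradiction (index-injective (setoid _) (all i) (all j) same-index) (<⇒≢ i<j)

module _ where
  open import Data.Vec using ([]; _∷_; here; there)
  open import Data.List using (_∷_)

  elements : ∀ {n} → Subset n → List (Fin n)
  elements []            = []
  elements (inside  ∷ p) = zero ∷ map suc (elements p)
  elements (outside ∷ p) = map suc (elements p)

  length-elements : ∀ {n} (p : Subset n) → length (elements p) ≡ ∣ p ∣
  length-elements []            = refl
  length-elements (inside  ∷ p) = cong suc (trans (length-map suc (elements p)) (length-elements p))
  length-elements (outside ∷ p) = trans (length-map suc (elements p)) (length-elements p)

  ∈-elements : ∀ {n} {p : Subset n} {x} → x ∈ p → x ∈ₗ elements p
  ∈-elements {p = inside  ∷ p} here        = here refl
  ∈-elements {p = inside  ∷ p} (there x∈p) = there (∈-map⁺ suc (∈-elements x∈p))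
  ∈-elements {p = outside ∷ p} (there x∈p) = ∈-map⁺ suc (∈-elements x∈p)

module AbelianGroupIdentities {a} {A : Set a} {_+_ : Op₂ A} {0# : A} { -_ : Op₁ A}
  (isAbelianGroup : IsAbelianGroup _≡_ _+_ 0# -_) where

  open IsAbelianGroup isAbelianGroup using (_-_; assoc; comm)
  private
    abelianGroup : AbelianGroup a a
    abelianGroup = record { isAbelianGroup = isAbelianGroup }
  open AbelianGroupProperties abelianGroup
    using (⁻¹-anti-homo‿-; ⁻¹-∙-comm; //-rightDividesˡ; //-rightDividesʳ; \\-leftDividesʳ) public
  open CommutativeSemigroupProperties (AbelianGroup.commutativeSemigroup abelianGroup)
    using (interchange)

  x+[y-x]≡y : ∀ x y → x + (y - x) ≡ y
  x+[y-x]≡y x y = trans (comm x (y - x)) (//-rightDividesˡ x y)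

  x-[x-y]≡y : ∀ x y → x - (x - y) ≡ y
  x-[x-y]≡y x y = trans (cong (x +_) (⁻¹-anti-homo‿- x y)) (x+[y-x]≡y x y)

  [x-y]+[y-z]≡x-z : ∀ x y z → (x - y) + (y - z) ≡ x - z
  [x-y]+[y-z]≡x-z x y z = trans (assoc x (- y) (y - z)) (cong (x +_) (\\-leftDividesʳ y (- z)))

  [x-z]-[y-z]≡x-y : ∀ x y z → (x - z) - (y - z) ≡ x - y
  [x-z]-[y-z]≡x-y x y z = trans (cong ((x - z) +_) (⁻¹-anti-homo‿- y z)) ([x-y]+[y-z]≡x-z x z y)

  [z-x]-[z-y]≡y-x : ∀ x y z → (z - x) - (z - y) ≡ y - x
  [z-x]-[z-y]≡y-x x y z = begin
    (z - x) - (z - y)  ≡⟨ cong ((z - x) +_) (⁻¹-anti-homo‿- z y) ⟩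
    (z - x) + (y - z)  ≡⟨ comm (z - x) (y - z) ⟩
    (y - z) + (z - x)  ≡⟨ [x-y]+[y-z]≡x-z y z x ⟩
    y - x              ∎
    where open ≡-Reasoning

  x-[y-x]≡[x+x]-y : ∀ x y → x - (y - x) ≡ (x + x) - y
  x-[y-x]≡[x+x]-y x y = trans (cong (x +_) (⁻¹-anti-homo‿- y x)) (sym (assoc x x (- y)))

  x+[[y-x]+z]≡y+z : ∀ x y z → x + ((y - x) + z) ≡ y + z
  x+[[y-x]+z]≡y+z x y z = trans (sym (assoc x (y - x) z)) (cong (_+ z) (x+[y-x]≡y x y))

  [x-y]+[x-y]≡[x+x]-[y+y] : ∀ x y → (x - y) + (x - y) ≡ (x + x) - (y + y)
  [x-y]+[x-y]≡[x+x]-[y+y] x y =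
    trans (interchange x (- y) x (- y)) (cong ((x + x) +_) (⁻¹-∙-comm y y))

module FiniteAbelianGroup {n} {_+_ : Op₂ (Fin n)} {0# : Fin n} { -_ : Op₁ (Fin n)}
  (isAbelianGroup : IsAbelianGroup _≡_ _+_ 0# -_) where

  open IsAbelianGroup isAbelianGroup using (_-_) public
  open AbelianGroupIdentities isAbelianGroup public

  infixl 6 _⊞_ _⊟_
  _⊞_ _⊟_ : List (Fin n) → List (Fin n) → List (Fin n)
  X ⊞ Y = cartesianProductWith _+_ X Y
  X ⊟ Y = cartesianProductWith _-_ X Y

  ∃-far-from-halves : ∀ (B S : List (Fin n)) {h} → h ∉ₗ S ⊟ S ⊟ S → length B +ℕ length B < n →
                      ∃ λ a → a ∉ₗ B × (a + a) - h ∉ₗ S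
  ∃-far-from-halves B S {h} h∉S⊟S⊟S |B|+|B|<n
    with a₀ , a₀∉B ← length<n⇒∃∉ B (≤-<-trans (m≤m+n _ _) |B|+|B|<n)
       | any? (((a₀ + a₀) - h) ≟_) S
  ... | no far₀ = a₀ , a₀∉B , far₀
  ... | yes near₀
    with a₁ , a₁∉B++a₀+B ← length<n⇒∃∉ (B ++ map (a₀ +_) B)
           (≤-<-trans (length-++-≤ B (map (a₀ +_) B) ≤-refl (length-map-≤ (a₀ +_) B ≤-refl))
                      |B|+|B|<n)
       | any? (((a₁ + a₁) - h) ≟_) S
       | any? ((((a₁ - a₀) + (a₁ - a₀)) - h) ≟_) S
  ... | no far₁ | _ = a₁ , a₁∉B++a₀+B ∘ ∈-++⁺ˡ , far₁
  ... | yes _ | no far₂ = a₁ - a₀ , a₁-a₀∉B , far₂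
    where
    a₁-a₀∉B : a₁ - a₀ ∉ₗ B
    a₁-a₀∉B a₁-a₀∈B = a₁∉B++a₀+B (∈-++⁺ʳ B
      (subst (_∈ₗ map (a₀ +_) B) (x+[y-x]≡y a₀ a₁) (∈-map⁺ (a₀ +_) a₁-a₀∈B)))
  ... | yes near₁ | yes near₂ =
    contradiction (subst (_∈ₗ S ⊟ S ⊟ S) h-decomposes
                    (∈-cartesianProductWith⁺ _-_ (∈-cartesianProductWith⁺ _-_ near₁ near₂) near₀))
                  h∉S⊟S⊟S
    where
    open ≡-Reasoning
    h-decomposes : (((a₁ + a₁) - h) - (((a₁ - a₀) + (a₁ - a₀)) - h)) - ((a₀ + a₀) - h) ≡ h
    h-decomposes = begin
      (((a₁ + a₁) - h) - (((a₁ - a₀) + (a₁ - a₀)) - h)) - ((a₀ + a₀) - h)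
        ≡⟨ cong (_- ((a₀ + a₀) - h)) ([x-z]-[y-z]≡x-y (a₁ + a₁) _ h) ⟩
      ((a₁ + a₁) - ((a₁ - a₀) + (a₁ - a₀))) - ((a₀ + a₀) - h)
        ≡⟨ cong (λ t → ((a₁ + a₁) - t) - ((a₀ + a₀) - h)) ([x-y]+[x-y]≡[x+x]-[y+y] a₁ a₀) ⟩
      ((a₁ + a₁) - ((a₁ + a₁) - (a₀ + a₀))) - ((a₀ + a₀) - h)
        ≡⟨ cong (_- ((a₀ + a₀) - h)) (x-[x-y]≡y (a₁ + a₁) (a₀ + a₀)) ⟩
      (a₀ + a₀) - ((a₀ + a₀) - h)
        ≡⟨ x-[x-y]≡y (a₀ + a₀) h ⟩
      h ∎

-- Opened only now: it would clash with the list and vector constructors used above.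
open import Data.Vec.Functional using (_∷_)

-- The numbers of values excluded in the last greedy step (F₁, the k translates y + S of the earlier
-- summands, and the (2C)³ values putting the deficit into S ⊟ S ⊟ S) and in the choice of a after m
-- summands (the list B in ∃-pair-completion).
deficitBound pairBound : ℕ → ℕ → ℕ
deficitBound C k = C +ℕ k * (C +ℕ C) +ℕ (C +ℕ C) * (C +ℕ C) * (C +ℕ C)
pairBound    C m = C +ℕ C +ℕ m * (C +ℕ C) +ℕ m * (C +ℕ C)

module AdmissibleFamilies {n} {_+_ : Op₂ (Fin n)} {0# : Fin n} { -_ : Op₁ (Fin n)}
  (isAbelianGroup : IsAbelianGroup _≡_ _+_ 0# -_)
  {C : ℕ} (F₁ F₂ : Subset n) (∣F₁∣≤C : ∣ F₁ ∣ ≤ C) (∣F₂∣≤C : ∣ F₂ ∣ ≤ C) where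

  open FiniteAbelianGroup isAbelianGroup public

  Separated : Fin n → Fin n → Set
  Separated x y = x - y ∉ F₂ × y - x ∉ F₂

  Admissible : ∀ {m} → (Fin m → Fin n) → Set
  Admissible y = (∀ i → y i ∉ F₁) × (∀ i j → i ≢ j → y i - y j ∉ F₂)

  ∷-admissible : ∀ {m x} {y : Fin m → Fin n} →
                 x ∉ F₁ → (∀ i → Separated x (y i)) → Admissible y → Admissible (x ∷ y)
  ∷-admissible {x = x} {y} x∉F₁ separated (y∉F₁ , y-y∉F₂) = avoids-F₁ , avoids-F₂
    where
    avoids-F₁ : ∀ i → (x ∷ y) i ∉ F₁
    avoids-F₁ zero    = x∉F₁
    avoids-F₁ (suc i) = y∉F₁ i
    avoids-F₂ : ∀ i j → i ≢ j → (x ∷ y) i - (x ∷ y) j ∉ F₂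
    avoids-F₂ zero    zero    i≢j = contradiction refl i≢j
    avoids-F₂ zero    (suc j) _   = proj₁ (separated j)
    avoids-F₂ (suc i) zero    _   = proj₂ (separated i)
    avoids-F₂ (suc i) (suc j) i≢j = y-y∉F₂ i j (i≢j ∘ cong suc)

  separated-reflect : ∀ h {x y} → Separated x y → Separated (h - x) (h - y)
  separated-reflect h {x} {y} (x-y∉F₂ , y-x∉F₂) =
    subst (_∉ F₂) (sym ([z-x]-[z-y]≡y-x x y h)) y-x∉F₂ ,
    subst (_∉ F₂) (sym ([z-x]-[z-y]≡y-x y x h)) x-y∉F₂

  S : List (Fin n)
  S = elements F₂ ++ map -_ (elements F₂)

  ∉S⇒separated : ∀ {x y} → x - y ∉ₗ S → Separated x y
  ∉S⇒separated {x} {y} x-y∉S = x-y∉F₂ , y-x∉F₂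
    where
    x-y∉F₂ : x - y ∉ F₂
    x-y∉F₂ = x-y∉S ∘ ∈-++⁺ˡ ∘ ∈-elements
    y-x∉F₂ : y - x ∉ F₂
    y-x∉F₂ y-x∈F₂ = x-y∉S (∈-++⁺ʳ (elements F₂) (subst (_∈ₗ map -_ (elements F₂))
      (⁻¹-anti-homo‿- y x) (∈-map⁺ -_ (∈-elements y-x∈F₂))))

  ∉⊞S⇒separated : ∀ {x y Y} → x ∉ₗ Y ⊞ S → y ∈ₗ Y → Separated x y
  ∉⊞S⇒separated {x} {y} {Y} x∉Y⊞S y∈Y = ∉S⇒separated λ x-y∈S →
    x∉Y⊞S (subst (_∈ₗ Y ⊞ S) (x+[y-x]≡y y x) (∈-cartesianProductWith⁺ _+_ y∈Y x-y∈S))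

  length-F₁≤ : length (elements F₁) ≤ C
  length-F₁≤ = ≤-trans (≤-reflexive (length-elements F₁)) ∣F₁∣≤C

  length-S≤ : length S ≤ C +ℕ C
  length-S≤ = length-++-≤ (elements F₂) (map -_ (elements F₂))
                length-F₂≤ (length-map-≤ -_ (elements F₂) length-F₂≤)
    where length-F₂≤ = ≤-trans (≤-reflexive (length-elements F₂)) ∣F₂∣≤C

  length-⊞S≤ : ∀ {m} Y → length Y ≤ m → length (Y ⊞ S) ≤ m * (C +ℕ C)
  length-⊞S≤ Y |Y|≤m =
    ≤-trans (≤-reflexive (length-cartesianProductWith _+_ Y S)) (*-mono-≤ |Y|≤m length-S≤)

  length-S⊟S⊟S≤ : length (S ⊟ S ⊟ S) ≤ (C +ℕ C) * (C +ℕ C) * (C +ℕ C)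
  length-S⊟S⊟S≤ = ≤-trans
    (≤-reflexive (trans (length-cartesianProductWith _-_ (S ⊟ S) S)
                        (cong (_* length S) (length-cartesianProductWith _-_ S S))))
    (*-mono-≤ (*-mono-≤ length-S≤ length-S≤) length-S≤)

  ∃-extension : ∀ {m} {y : Fin m → Fin n} → Admissible y → (E : List (Fin n)) →
                C +ℕ m * (C +ℕ C) +ℕ length E < n →
                ∃ λ x → x ∉ₗ E × Admissible (x ∷ y)
  ∃-extension {m} {y} admissible E bound =
    let x , x∉X = length<n⇒∃∉ X (≤-<-trans |X|≤ bound)
        x-separated i = ∉⊞S⇒separated (x∉X ∘ ∈-++⁺ˡ ∘ ∈-++⁺ʳ (elements F₁)) (∈-tabulate⁺ i)
    in x , x∉X ∘ ∈-++⁺ʳ (elements F₁ ++ tabulate y ⊞ S) ,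
       ∷-admissible (x∉X ∘ ∈-++⁺ˡ ∘ ∈-++⁺ˡ ∘ ∈-elements) x-separated admissible
    where
    X : List (Fin n)
    X = (elements F₁ ++ tabulate y ⊞ S) ++ E
    |X|≤ : length X ≤ C +ℕ m * (C +ℕ C) +ℕ length E
    |X|≤ = length-++-≤ (elements F₁ ++ tabulate y ⊞ S) E
             (length-++-≤ (elements F₁) (tabulate y ⊞ S) length-F₁≤
               (length-⊞S≤ (tabulate y) (≤-reflexive (length-tabulate y))))
             ≤-refl

  ∃-admissible : ∀ m → C +ℕ m * (C +ℕ C) < n → ∃ (Admissible {m})
  ∃-admissible zero    _     = (λ ()) , (λ ()) , (λ ())
  ∃-admissible (suc m) bound =
    let y , admissible      = ∃-admissible m smaller-bound
        x , _ , admissible′ =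
          ∃-extension admissible [] (subst (_< n) (sym (+-identityʳ _)) smaller-bound)
    in x ∷ y , admissible′
    where
    smaller-bound : C +ℕ m * (C +ℕ C) < n
    smaller-bound = ≤-<-trans (+-monoʳ-≤ C (m≤n+m _ (C +ℕ C))) bound

  ∃-admissible-with-g-ΣL∉S⊟S⊟S : ∀ k g → deficitBound C k < n →
    ∃ λ (L : Fin (suc k) → Fin n) → Admissible L × g - groupSum _+_ 0# L ∉ₗ S ⊟ S ⊟ S
  ∃-admissible-with-g-ΣL∉S⊟S⊟S k g bound =
    let R , admissible = ∃-admissible k (≤-<-trans (m≤m+n _ _) bound)
        σ = groupSum _+_ 0# R
        -- x ∈ E exactly when the deficit g - (x + σ) lies in S ⊟ S ⊟ S.
        E = map (λ t → (g - t) - σ) (S ⊟ S ⊟ S)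
        x , x∉E , admissible′ =
          ∃-extension admissible E
            (≤-<-trans (+-monoʳ-≤ _ (length-map-≤ _ (S ⊟ S ⊟ S) length-S⊟S⊟S≤)) bound)
        recovers-x = trans (cong (_- σ) (x-[x-y]≡y g (x + σ))) (//-rightDividesʳ σ x)
    in x ∷ R , admissible′ , λ g-ΣL∈ → x∉E (subst (_∈ₗ E) recovers-x (∈-map⁺ _ g-ΣL∈))

  ∃-pair-completion : ∀ {m h} {L : Fin m → Fin n} → Admissible L → h ∉ₗ S ⊟ S ⊟ S →
                      pairBound C m +ℕ pairBound C m < n →
                      ∃ λ a → Admissible (a ∷ (h - a) ∷ L)
  ∃-pair-completion {m} {h} {L} admissible h∉S⊟S⊟S bound =
    let a , a∉B , far = ∃-far-from-halves B S h∉S⊟S⊟S (≤-<-trans (+-mono-≤ |B|≤ |B|≤) bound)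
    in a , admissible-if a∉B far
    where
    F₁ˡ hF₁ hL : List (Fin n)
    F₁ˡ = elements F₁
    hF₁ = map (_-_ h) F₁ˡ
    hL  = map (_-_ h) (tabulate L)

    B₀ B : List (Fin n)
    B₀ = (F₁ˡ ++ hF₁) ++ tabulate L ⊞ S
    B  = B₀ ++ hL ⊞ S

    |B|≤ : length B ≤ pairBound C m
    |B|≤ = length-++-≤ B₀ (hL ⊞ S)
             (length-++-≤ (F₁ˡ ++ hF₁) (tabulate L ⊞ S)
               (length-++-≤ F₁ˡ hF₁ length-F₁≤ (length-map-≤ (_-_ h) F₁ˡ length-F₁≤))
               (length-⊞S≤ (tabulate L) (≤-reflexive (length-tabulate L))))
             (length-⊞S≤ hL (length-map-≤ (_-_ h) (tabulate L) (≤-reflexive (length-tabulate L))))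

    admissible-if : ∀ {a} → a ∉ₗ B → (a + a) - h ∉ₗ S → Admissible (a ∷ (h - a) ∷ L)
    admissible-if {a} a∉B far =
      ∷-admissible a∉F₁ a-separated (∷-admissible h-a∉F₁ h-a-separated admissible)
      where
      a∉F₁ : a ∉ F₁
      a∉F₁ = a∉B ∘ ∈-++⁺ˡ ∘ ∈-++⁺ˡ ∘ ∈-++⁺ˡ ∘ ∈-elements
      h-a∉F₁ : h - a ∉ F₁
      h-a∉F₁ h-a∈F₁ = a∉B (∈-++⁺ˡ (∈-++⁺ˡ (∈-++⁺ʳ F₁ˡ
        (subst (_∈ₗ hF₁) (x-[x-y]≡y h a) (∈-map⁺ (_-_ h) (∈-elements h-a∈F₁))))))
      h-a-separated : ∀ i → Separated (h - a) (L i)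
      h-a-separated i = subst (Separated (h - a)) (x-[x-y]≡y h (L i)) (separated-reflect h
        (∉⊞S⇒separated (a∉B ∘ ∈-++⁺ʳ B₀) (∈-map⁺ (_-_ h) (∈-tabulate⁺ i))))
      a-separated : ∀ i → Separated a ((h - a ∷ L) i)
      a-separated zero    = ∉S⇒separated (subst (_∉ₗ S) (sym (x-[y-x]≡[x+x]-y a h)) far)
      a-separated (suc i) = ∉⊞S⇒separated (a∉B ∘ ∈-++⁺ˡ ∘ ∈-++⁺ʳ (F₁ˡ ++ hF₁)) (∈-tabulate⁺ i)

lemma5p7 : (C s : ℕ) → 1 ≤ C → 3 ≤ s →
    ∃[ n₀ ] ((n : ℕ) → n₀ ≤ n →
      (_+_ : Fin n → Fin n → Fin n) (0# : Fin n) (-_ : Fin n → Fin n) →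
      IsAbelianGroup _≡_ _+_ 0# -_ →
      (g : Fin n) (F₁ F₂ : Subset n) → ∣ F₁ ∣ ≤ C → ∣ F₂ ∣ ≤ C →
      ∃[ y ] (groupSum _+_ 0# {s} y ≡ g
             × ((i : Fin s) → y i ∉ F₁)
             × ((i j : Fin s) → i ≢ j → (y i + (- y j)) ∉ F₂)))
lemma5p7 C (suc (suc (suc k))) _ (s≤s (s≤s (s≤s _))) =
  suc (deficitBound C k +ℕ (pairBound C (suc k) +ℕ pairBound C (suc k))) ,
  λ n bound _+_ 0# -_ isAbelianGroup g F₁ F₂ ∣F₁∣≤C ∣F₂∣≤C →
    let open AdmissibleFamilies isAbelianGroup F₁ F₂ ∣F₁∣≤C ∣F₂∣≤C
        L , admissible , g-ΣL∉S⊟S⊟S =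
          ∃-admissible-with-g-ΣL∉S⊟S⊟S k g (≤-<-trans (m≤m+n _ _) bound)
        ΣL = groupSum _+_ 0# L
        a , admissible′ =
          ∃-pair-completion admissible g-ΣL∉S⊟S⊟S (≤-<-trans (m≤n+m _ (deficitBound C k)) bound)
    in a ∷ ((g - ΣL) - a) ∷ L ,
       trans (x+[[y-x]+z]≡y+z a (g - ΣL) ΣL) (//-rightDividesˡ ΣL g) ,
       admissible′
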